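{- Let $\lambda$ be a nonzero real number. For every integer $n \geq 0$, \[ b_{n,\lambda}(x)=\sum_{m=0}^n \sum_{k=0}^m \binom{n}{m}\lambda^{m-k}S_1(m,k)\,b_{n-m,\lambda}\,x^k . \]
   Context: For a nonzero real $\lambda$, the degenerate ordered Bell polynomials $b_{n,\lambda}(x)$ are defined by the formal power series identity \[ \frac{1}{2-(1+\lambda t)^{1/\lambda}}(1+\lambda t)^{x/\lambda}=\sum_{n=0}^\infty b_{n,\lambda}(x)\frac{t^n}{n!}, \] where $(1+\lambda t)^{a/\lambda}=\exp\big(\tfrac{a}{\lambda}\log(1+\lambda t)\big)$. The degenerate ordered Bell numbers are $b_{n,\lambda}=b_{n,\lambda}(0)$. The (signed) Stirling numbers of the first kind $S_1(n,l)$ are defined by $x(x-1)\cdots(x-n+1)=\sum_{l=0}^n S_1(n,l)x^l$. -}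

module Defs where

open import Level using (Level; _⊔_) renaming (suc to lsuc)
open import Algebra.Bundles using (CommutativeRing)
open import Data.Nat as ℕ using (ℕ; zero; suc; _∸_)
open import Data.Nat using (_!)
open import Data.Nat.Combinatorics using (_C_)
open import Data.Integer as ℤ using (ℤ; +_; -[1+_])
open import Data.List using (List; []; _∷_)
open import Relation.Nullary using (¬_)

-- Integer polynomials as coefficient lists (lowest degree first), used
-- to define the signed Stirling numbers of the first kind exactly as in
-- the paper:  x(x-1)...(x-n+1) = Σ_l S₁(n,l) x^l.

infixl 6 _⊕_
_⊕_ : List ℤ → List ℤ → List ℤ
[] ⊕ q = q
(a ∷ p) ⊕ [] = a ∷ p
(a ∷ p) ⊕ (b ∷ q) = (a ℤ.+ b) ∷ (p ⊕ q)

scaleℤ : ℤ → List ℤ → List ℤ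
scaleℤ c [] = []
scaleℤ c (a ∷ p) = (c ℤ.* a) ∷ scaleℤ c p

mulXminus : ℕ → List ℤ → List ℤ
mulXminus j p = (+ 0 ∷ p) ⊕ scaleℤ (ℤ.- (+ j)) p

fallingPoly : ℕ → List ℤ
fallingPoly zero = + 1 ∷ []
fallingPoly (suc n) = mulXminus n (fallingPoly n)

coeff : List ℤ → ℕ → ℤ
coeff [] l = + 0
coeff (a ∷ p) zero = a
coeff (a ∷ p) (suc l) = coeff p l

S₁ : ℕ → ℕ → ℤ
S₁ n l = coeff (fallingPoly n) l

module RingHelpers {c ℓ : Level} (R : CommutativeRing c ℓ) where
  open CommutativeRing R

  fromℕ : ℕ → Carrier
  fromℕ zero = 0#
  fromℕ (suc n) = 1# + fromℕ n

  fromℤ : ℤ → Carrier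
  fromℤ (+ n) = fromℕ n
  fromℤ -[1+ n ] = - fromℕ (suc n)

  infixr 8 _^_
  _^_ : Carrier → ℕ → Carrier
  a ^ zero = 1#
  a ^ suc k = a * (a ^ k)

  sumLe : ℕ → (ℕ → Carrier) → Carrier
  sumLe zero f = f 0
  sumLe (suc n) f = sumLe n f + f (suc n)

  sumLt : ℕ → (ℕ → Carrier) → Carrier
  sumLt zero f = 0#
  sumLt (suc n) f = sumLt n f + f n

-- A field of characteristic zero (the standard library has no fields
-- and no real numbers; ℝ is one instance).

record IsCharZeroField {c ℓ : Level} (R : CommutativeRing c ℓ) : Set (c ⊔ ℓ) where
  open CommutativeRing R
  open RingHelpers R
  field
    inv       : (a : Carrier) → ¬ (a ≈ 0#) → Carrier
    inv-right : (a : Carrier) (p : ¬ (a ≈ 0#)) → a * inv a p ≈ 1#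
    charZero  : (n : ℕ) → ¬ (fromℕ (suc n) ≈ 0#)

module DegenerateBell {c ℓ : Level} (R : CommutativeRing c ℓ) (F : IsCharZeroField R) where
  open CommutativeRing R
  open RingHelpers R
  open IsCharZeroField F

  PS : Set c
  PS = ℕ → Carrier

  const : Carrier → PS
  const a zero = a
  const a (suc n) = 0#

  _⊞_ : PS → PS → PS
  (f ⊞ g) n = f n + g n

  _⊟_ : PS → PS → PS
  (f ⊟ g) n = f n - g n

  scalePS : Carrier → PS → PS
  scalePS a f n = a * f n

  _⋆_ : PS → PS → PS
  (f ⋆ g) n = sumLe n (λ i → f i * g (n ∸ i))

  powPS : PS → ℕ → PS
  powPS f zero = const 1#
  powPS f (suc k) = f ⋆ powPS f k

  recipSuc : ℕ → Carrier
  recipSuc k = inv (fromℕ (suc k)) (charZero k)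

  invFact : ℕ → Carrier
  invFact zero = 1#
  invFact (suc k) = invFact k * recipSuc k

  -- log(1+u) = Σ_{k≥1} (-1)^{k+1} u^k / k   (for u with zero constant
  -- term, only k ≤ n contribute to the n-th coefficient)
  log1+ : PS → PS
  log1+ u n = sumLt n (λ k → ((- 1#) ^ k) * recipSuc k * powPS u (suc k) n)

  -- exp(v) = Σ_{k≥0} v^k / k!   (for v with zero constant term, only
  -- k ≤ n contribute to the n-th coefficient)
  expPS : PS → PS
  expPS v n = sumLe n (λ k → invFact k * powPS v k n)

  -- multiplicative inverse of a series f with constant term 1:
  -- 1/f = 1/(1-(1-f)) = Σ_{k≥0} (1-f)^k  (only k ≤ n contribute to the
  -- n-th coefficient since 1-f has zero constant term)
  invPS : PS → PS
  invPS f n = sumLe n (λ k → powPS (const 1# ⊟ f) k n)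

  lamT : Carrier → PS
  lamT lam zero = 0#
  lamT lam (suc zero) = lam
  lamT lam (suc (suc n)) = 0#

  -- (1+λt)^{a/λ} = exp( (a/λ) log(1+λt) )
  degPow : (lam : Carrier) → ¬ (lam ≈ 0#) → Carrier → PS
  degPow lam lam≢0 a = expPS (scalePS (a * inv lam lam≢0) (log1+ (lamT lam)))

  -- generating function  (1+λt)^{x/λ} / (2 - (1+λt)^{1/λ})
  genFun : (lam : Carrier) → ¬ (lam ≈ 0#) → Carrier → PS
  genFun lam lam≢0 x =
    invPS (const (1# + 1#) ⊟ degPow lam lam≢0 1#) ⋆ degPow lam lam≢0 x

  bPoly : (lam : Carrier) → ¬ (lam ≈ 0#) → ℕ → Carrier → Carrier
  bPoly lam lam≢0 n x = fromℕ (n !) * genFun lam lam≢0 x n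

  bNum : (lam : Carrier) → ¬ (lam ≈ 0#) → ℕ → Carrier
  bNum lam lam≢0 n = bPoly lam lam≢0 n 0#

module Submission where

-- Write E = (1+λt)^{x/λ} = exp((x/λ)·log(1+λt)) and G = 1/(2-(1+λt)^{1/λ}).
-- The generating function of b_{n,λ}(x) is G·E, and that of b_{n,λ} is G,
-- because E = 1 when x = 0.  Three facts combine to give the theorem.
--  (1) E solves (1+λt)·E' = x·E, since exp(v)' = v'·exp(v) and
--      (1+λt)·log(1+λt)' = λ.  Comparing coefficients gives
--      (m+1)·E_{m+1} = (x-mλ)·E_m, so m!·E_m is the degenerate falling
--      factorial (x)_{m,λ} = x(x-λ)⋯(x-(m-1)λ).
--  (2) (x)_{m,λ} = Σ_k λ^{m-k} S₁(m,k) x^k, the homogenised definition of S₁,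
--      proved from the recurrence S₁(m+1,k) = S₁(m,k-1) - m·S₁(m,k).
--  (3) A product of exponential generating functions is a binomial
--      convolution: n!(E·G)_n = Σ_m C(n,m)·(m!E_m)·((n-m)!G_{n-m}).

open import Defs
open import Level using (Level)
open import Algebra.Bundles using (CommutativeRing)
open import Data.Nat as ℕ using (ℕ; zero; suc; _∸_; _≤_; _<_; z≤n; s≤s; _!)
import Data.Nat.Properties as ℕP
open import Data.Nat.Combinatorics using (_C_; nCk≡n!/k![n-k]!; k![n∸k]!∣n!)
open import Data.Nat.DivMod using (m/n*n≡m)
open import Data.Integer as ℤ using (ℤ; +_; -[1+_])
import Data.Integer.Properties as ℤP
open import Data.List using (List; []; _∷_)
open import Data.Sum using (inj₁; inj₂)
open import Data.Empty using (⊥-elim)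
open import Relation.Nullary using (¬_)
open import Relation.Binary.PropositionalEquality as P using (_≡_)

binomial-factorials : ∀ {n m} → m ≤ n → (n C m) ℕ.* (m ! ℕ.* (n ∸ m) !) ≡ n !
binomial-factorials {n} {m} m≤n =
  P.trans (P.cong (ℕ._* (m ! ℕ.* (n ∸ m) !)) (nCk≡n!/k![n-k]! m≤n))
          (m/n*n≡m (k![n∸k]!∣n! m≤n))
  where instance _ = ℕP._!*_!≢0 m (n ∸ m)

coeff-⊕ : (p q : List ℤ) (l : ℕ) → coeff (p ⊕ q) l ≡ coeff p l ℤ.+ coeff q l
coeff-⊕ [] q l = P.sym (ℤP.+-identityˡ _)
coeff-⊕ (a ∷ p) [] l = P.sym (ℤP.+-identityʳ _)
coeff-⊕ (a ∷ p) (b ∷ q) zero = P.refl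
coeff-⊕ (a ∷ p) (b ∷ q) (suc l) = coeff-⊕ p q l

coeff-scale : (d : ℤ) (p : List ℤ) (l : ℕ) → coeff (scaleℤ d p) l ≡ d ℤ.* coeff p l
coeff-scale d [] l = P.sym (ℤP.*-zeroʳ d)
coeff-scale d (a ∷ p) zero = P.refl
coeff-scale d (a ∷ p) (suc l) = coeff-scale d p l

-- The Stirling recurrence S₁(m+1,k) = S₁(m,k-1) - m·S₁(m,k), read off from
-- (x)_{m+1} = x·(x)_m - m·(x)_m.  The first summand is the coefficient of the
-- shifted list 0 ∷ (x)_m: it is 0 at k = 0 and S₁(m,k-1) otherwise.
S₁-suc : (m k : ℕ) →
  S₁ (suc m) k ≡ coeff (+ 0 ∷ fallingPoly m) k ℤ.+ ℤ.- (+ m) ℤ.* S₁ m k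
S₁-suc m k =
  P.trans (coeff-⊕ (+ 0 ∷ fallingPoly m) (scaleℤ (ℤ.- (+ m)) (fallingPoly m)) k)
          (P.cong (λ z → coeff (+ 0 ∷ fallingPoly m) k ℤ.+ z)
                  (coeff-scale (ℤ.- (+ m)) (fallingPoly m) k))

-- (x)_m has degree m.
S₁-vanish : ∀ {m k} → m < k → S₁ m k ≡ + 0
S₁-vanish {zero} {suc k} _ = P.refl
S₁-vanish {suc m} {suc k} (s≤s m<k) =
  P.trans (S₁-suc m (suc k))
    (P.trans (P.cong₂ (λ a b → a ℤ.+ ℤ.- (+ m) ℤ.* b)
                      (S₁-vanish m<k) (S₁-vanish (ℕP.m<n⇒m<1+n m<k)))
             (P.trans (ℤP.+-identityˡ _) (ℤP.*-zeroʳ (ℤ.- (+ m)))))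

module RingFacts {c ℓ : Level} (R : CommutativeRing c ℓ) where
  open CommutativeRing R hiding (zero)
  open RingHelpers R
  open import Algebra.Properties.Ring ring
  open import Relation.Binary.Reasoning.Setoid setoid public
  open import Algebra.Solver.CommutativeMonoid +-commutativeMonoid public
    using () renaming (solve to +-solve; _⊕_ to _:+_; _⊜_ to _⊜+_)
  open import Algebra.Solver.CommutativeMonoid *-commutativeMonoid public
    using () renaming (solve to *-solve; _⊕_ to _:*_; _⊜_ to _⊜*_)

  subtract : ∀ {a b d} → a + b ≈ d → a ≈ d - b
  subtract {a} {b} {d} a+b≈d = begin
    a              ≈⟨ sym (+-identityʳ _) ⟩
    a + 0#         ≈⟨ +-congˡ (sym (-‿inverseʳ b)) ⟩
    a + (b - b)    ≈⟨ sym (+-assoc _ _ _) ⟩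
    (a + b) - b    ≈⟨ +-congʳ a+b≈d ⟩
    d - b          ∎

  fromℕ-+ : ∀ a b → fromℕ (a ℕ.+ b) ≈ fromℕ a + fromℕ b
  fromℕ-+ zero b = sym (+-identityˡ _)
  fromℕ-+ (suc a) b = trans (+-congˡ (fromℕ-+ a b)) (sym (+-assoc _ _ _))

  fromℕ-* : ∀ a b → fromℕ (a ℕ.* b) ≈ fromℕ a * fromℕ b
  fromℕ-* zero b = sym (zeroˡ _)
  fromℕ-* (suc a) b = begin
    fromℕ (b ℕ.+ a ℕ.* b)            ≈⟨ fromℕ-+ b (a ℕ.* b) ⟩
    fromℕ b + fromℕ (a ℕ.* b)        ≈⟨ +-cong (sym (*-identityˡ _)) (fromℕ-* a b) ⟩
    1# * fromℕ b + fromℕ a * fromℕ b ≈⟨ sym (distribʳ _ _ _) ⟩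
    (1# + fromℕ a) * fromℕ b         ∎

  fromℤ-⊖ : ∀ m n → fromℤ (m ℤ.⊖ n) ≈ fromℕ m - fromℕ n
  fromℤ-⊖ m zero = begin
    fromℤ (m ℤ.⊖ 0)  ≈⟨ reflexive (P.cong fromℤ (ℤP.⊖-≥ {m} {0} z≤n)) ⟩
    fromℕ m          ≈⟨ sym (+-identityʳ _) ⟩
    fromℕ m + 0#     ≈⟨ +-congˡ (sym -0#≈0#) ⟩
    fromℕ m - 0#     ∎
  fromℤ-⊖ zero (suc n) =
    trans (reflexive (P.cong fromℤ (ℤP.⊖-≤ {0} {suc n} z≤n))) (sym (+-identityˡ _))
  fromℤ-⊖ (suc m) (suc n) = begin
    fromℤ (suc m ℤ.⊖ suc n)        ≈⟨ reflexive (P.cong fromℤ (ℤP.[1+m]⊖[1+n]≡m⊖n m n)) ⟩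
    fromℤ (m ℤ.⊖ n)                ≈⟨ fromℤ-⊖ m n ⟩
    fromℕ m - fromℕ n              ≈⟨ sym (+-identityʳ _) ⟩
    (fromℕ m - fromℕ n) + 0#       ≈⟨ +-congˡ (sym (-‿inverseʳ 1#)) ⟩
    (fromℕ m - fromℕ n) + (1# - 1#) ≈⟨ +-solve 4 (λ a b o d → ((a :+ b) :+ (o :+ d)) ⊜+ ((o :+ a) :+ (b :+ d))) refl _ _ _ _ ⟩
    (1# + fromℕ m) + (- fromℕ n - 1#) ≈⟨ +-congˡ (sym (-‿anti-homo-+ 1# (fromℕ n))) ⟩
    (1# + fromℕ m) - (1# + fromℕ n) ∎

  fromℤ-+ : ∀ a b → fromℤ (a ℤ.+ b) ≈ fromℤ a + fromℤ b
  fromℤ-+ (+ m) (+ n) = fromℕ-+ m n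
  fromℤ-+ (+ m) -[1+ n ] = fromℤ-⊖ m (suc n)
  fromℤ-+ -[1+ m ] (+ n) = trans (fromℤ-⊖ n (suc m)) (+-comm _ _)
  fromℤ-+ -[1+ m ] -[1+ n ] = begin
    - fromℕ (suc (suc (m ℕ.+ n)))      ≈⟨ -‿cong (reflexive (P.cong fromℕ (P.sym (ℕP.+-suc (suc m) n)))) ⟩
    - fromℕ (suc m ℕ.+ suc n)          ≈⟨ -‿cong (fromℕ-+ (suc m) (suc n)) ⟩
    - (fromℕ (suc m) + fromℕ (suc n))  ≈⟨ trans (-‿anti-homo-+ _ _) (+-comm _ _) ⟩
    - fromℕ (suc m) + - fromℕ (suc n)  ∎

  fromℤ-neg : ∀ z → fromℤ (ℤ.- z) ≈ - fromℤ z
  fromℤ-neg (+ zero) = sym -0#≈0#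
  fromℤ-neg (+ suc n) = refl
  fromℤ-neg -[1+ n ] = sym (-‿involutive _)

  fromℤ-ℕ* : ∀ j z → fromℤ (+ j ℤ.* z) ≈ fromℕ j * fromℤ z
  fromℤ-ℕ* j (+ k) = trans (reflexive (P.cong fromℤ (P.sym (ℤP.pos-* j k)))) (fromℕ-* j k)
  fromℤ-ℕ* j -[1+ k ] = begin
    fromℤ (+ j ℤ.* -[1+ k ])          ≈⟨ reflexive (P.cong fromℤ (P.sym (ℤP.neg-distribʳ-* (+ j) (+ suc k)))) ⟩
    fromℤ (ℤ.- (+ j ℤ.* + suc k))     ≈⟨ fromℤ-neg (+ j ℤ.* + suc k) ⟩
    - fromℤ (+ j ℤ.* + suc k)         ≈⟨ -‿cong (fromℤ-ℕ* j (+ suc k)) ⟩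
    - (fromℕ j * fromℕ (suc k))       ≈⟨ -‿distribʳ-* _ _ ⟩
    fromℕ j * - fromℕ (suc k)         ∎

  fromℤ-S₁-suc : ∀ m k →
    fromℤ (S₁ (suc m) k) ≈ fromℤ (coeff (+ 0 ∷ fallingPoly m) k) - fromℕ m * fromℤ (S₁ m k)
  fromℤ-S₁-suc m k = begin
    fromℤ (S₁ (suc m) k)                     ≈⟨ reflexive (P.cong fromℤ (S₁-suc m k)) ⟩
    fromℤ (A ℤ.+ ℤ.- (+ m) ℤ.* S₁ m k)       ≈⟨ fromℤ-+ A _ ⟩
    fromℤ A + fromℤ (ℤ.- (+ m) ℤ.* S₁ m k)   ≈⟨ +-congˡ (reflexive (P.cong fromℤ (P.sym (ℤP.neg-distribˡ-* (+ m) (S₁ m k))))) ⟩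
    fromℤ A + fromℤ (ℤ.- (+ m ℤ.* S₁ m k))   ≈⟨ +-congˡ (trans (fromℤ-neg (+ m ℤ.* S₁ m k)) (-‿cong (fromℤ-ℕ* m (S₁ m k)))) ⟩
    fromℤ A - fromℕ m * fromℤ (S₁ m k)       ∎
    where A = coeff (+ 0 ∷ fallingPoly m) k

  sumLe-cong≤ : ∀ n {f g : ℕ → Carrier} → (∀ i → i ≤ n → f i ≈ g i) → sumLe n f ≈ sumLe n g
  sumLe-cong≤ zero h = h 0 z≤n
  sumLe-cong≤ (suc n) h =
    +-cong (sumLe-cong≤ n (λ i i≤n → h i (ℕP.m≤n⇒m≤1+n i≤n))) (h (suc n) ℕP.≤-refl)

  sumLe-cong : ∀ n {f g : ℕ → Carrier} → (∀ i → f i ≈ g i) → sumLe n f ≈ sumLe n g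
  sumLe-cong n h = sumLe-cong≤ n (λ i _ → h i)

  sumLe-+ : ∀ n (f g : ℕ → Carrier) → sumLe n (λ i → f i + g i) ≈ sumLe n f + sumLe n g
  sumLe-+ zero f g = refl
  sumLe-+ (suc n) f g = trans (+-congʳ (sumLe-+ n f g))
    (+-solve 4 (λ a b d e → ((a :+ b) :+ (d :+ e)) ⊜+ ((a :+ d) :+ (b :+ e))) refl _ _ _ _)

  sumLe-*ˡ : ∀ n a (f : ℕ → Carrier) → a * sumLe n f ≈ sumLe n (λ i → a * f i)
  sumLe-*ˡ zero a f = refl
  sumLe-*ˡ (suc n) a f = trans (distribˡ _ _ _) (+-congʳ (sumLe-*ˡ n a f))

  sumLe-*ʳ : ∀ n a (f : ℕ → Carrier) → sumLe n f * a ≈ sumLe n (λ i → f i * a)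
  sumLe-*ʳ zero a f = refl
  sumLe-*ʳ (suc n) a f = trans (distribʳ _ _ _) (+-congʳ (sumLe-*ʳ n a f))

  sumLe-zero : ∀ n (f : ℕ → Carrier) → (∀ i → i ≤ n → f i ≈ 0#) → sumLe n f ≈ 0#
  sumLe-zero n f h = trans (sumLe-cong≤ n h) (go n)
    where
    go : ∀ n → sumLe n (λ _ → 0#) ≈ 0#
    go zero = refl
    go (suc n) = trans (+-identityʳ _) (go n)

  sumLt-zero : ∀ n (f : ℕ → Carrier) → (∀ i → i < n → f i ≈ 0#) → sumLt n f ≈ 0#
  sumLt-zero zero f h = refl
  sumLt-zero (suc n) f h =
    trans (+-cong (sumLt-zero n f (λ i i<n → h i (ℕP.m<n⇒m<1+n i<n))) (h n ℕP.≤-refl))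
          (+-identityˡ _)

  sumLe-head : ∀ n (f : ℕ → Carrier) → sumLe (suc n) f ≈ f 0 + sumLe n (λ i → f (suc i))
  sumLe-head zero f = refl
  sumLe-head (suc n) f = trans (+-congʳ (sumLe-head n f)) (+-assoc _ _ _)

  sumLe-reverse : ∀ n (f : ℕ → Carrier) → sumLe n f ≈ sumLe n (λ i → f (n ∸ i))
  sumLe-reverse zero f = refl
  sumLe-reverse (suc n) f = trans (+-congʳ (sumLe-reverse n f))
    (trans (+-comm _ _) (sym (sumLe-head n (λ i → f (suc n ∸ i)))))

  sumLe-swap : ∀ n m (G : ℕ → ℕ → Carrier) →
    sumLe n (λ i → sumLe m (λ j → G i j)) ≈ sumLe m (λ j → sumLe n (λ i → G i j))
  sumLe-swap zero m G = refl
  sumLe-swap (suc n) m G = trans (+-congʳ (sumLe-swap n m G))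
    (sym (sumLe-+ m (λ j → sumLe n (λ i → G i j)) (λ j → G (suc n) j)))

  sumLe-triangle : ∀ n (G : ℕ → ℕ → Carrier) →
    sumLe n (λ i → sumLe i (λ j → G j i))
      ≈ sumLe n (λ j → sumLe (n ∸ j) (λ k → G j (j ℕ.+ k)))
  sumLe-triangle zero G = refl
  sumLe-triangle (suc n) G = begin
    sumLe n (λ i → sumLe i (λ j → G j i)) + (sumLe n (λ j → G j (suc n)) + G (suc n) (suc n))
      ≈⟨ +-congʳ (sumLe-triangle n G) ⟩
    sumLe n column + (sumLe n (λ j → G j (suc n)) + G (suc n) (suc n))
      ≈⟨ sym (+-assoc _ _ _) ⟩
    (sumLe n column + sumLe n (λ j → G j (suc n))) + G (suc n) (suc n)
      ≈⟨ +-cong (sym (sumLe-+ n column (λ j → G j (suc n)))) lastColumn ⟩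
    sumLe n (λ j → column j + G j (suc n)) + sumLe (suc n ∸ suc n) (λ k → G (suc n) (suc n ℕ.+ k))
      ≈⟨ +-congʳ (sumLe-cong≤ n extendColumn) ⟩
    sumLe n (λ j → sumLe (suc n ∸ j) (λ k → G j (j ℕ.+ k)))
      + sumLe (suc n ∸ suc n) (λ k → G (suc n) (suc n ℕ.+ k)) ∎
    where
    column : ℕ → Carrier
    column j = sumLe (n ∸ j) (λ k → G j (j ℕ.+ k))
    lastColumn : G (suc n) (suc n) ≈ sumLe (suc n ∸ suc n) (λ k → G (suc n) (suc n ℕ.+ k))
    lastColumn rewrite ℕP.n∸n≡0 n | ℕP.+-identityʳ n = refl
    extendColumn : ∀ j → j ≤ n → column j + G j (suc n) ≈ sumLe (suc n ∸ j) (λ k → G j (j ℕ.+ k))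
    extendColumn j j≤n rewrite ℕP.+-∸-assoc 1 j≤n =
      +-congˡ (reflexive (P.cong (G j) (P.sym (P.trans (ℕP.+-suc j (n ∸ j))
                                                       (P.cong suc (ℕP.m+[n∸m]≡n j≤n))))))

  sumLe-truncate : ∀ N n (f : ℕ → Carrier) → n ≤ N → (∀ i → n < i → f i ≈ 0#) →
    sumLe N f ≈ sumLe n f
  sumLe-truncate zero .zero f z≤n h = refl
  sumLe-truncate (suc N) n f n≤1+N h with ℕP.m≤n⇒m<n∨m≡n n≤1+N
  ... | inj₁ (s≤s n≤N) =
    trans (+-cong (sumLe-truncate N n f n≤N h) (h (suc N) (s≤s n≤N))) (+-identityʳ _)
  ... | inj₂ P.refl = refl

  module DegenerateFalling (lam x : Carrier) where
    degFalling : ℕ → Carrier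
    degFalling zero = 1#
    degFalling (suc m) = (x - fromℕ m * lam) * degFalling m

    stirlingSum : ℕ → Carrier
    stirlingSum m = sumLe m (λ k → lam ^ (m ∸ k) * fromℤ (S₁ m k) * x ^ k)

    -- Multiplying by x shifts the coefficients S₁(m,k) up by one degree;
    -- this is the first half of the Stirling recurrence.
    stirlingSum-shift : ∀ m →
      sumLe (suc m) (λ k → lam ^ (suc m ∸ k) * fromℤ (coeff (+ 0 ∷ fallingPoly m) k) * x ^ k)
        ≈ x * stirlingSum m
    stirlingSum-shift m = begin
      sumLe (suc m) (λ k → lam ^ (suc m ∸ k) * fromℤ (coeff (+ 0 ∷ fallingPoly m) k) * x ^ k)
        ≈⟨ sumLe-head m _ ⟩
      lam ^ suc m * 0# * 1# + sumLe m (λ k → lam ^ (m ∸ k) * fromℤ (S₁ m k) * (x * x ^ k))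
        ≈⟨ +-cong (trans (*-congʳ (zeroʳ _)) (zeroˡ _))
                  (sumLe-cong m (λ k → *-solve 4 (λ l s y z → ((l :* s) :* (y :* z)) ⊜* (y :* ((l :* s) :* z)))
                                               refl (lam ^ (m ∸ k)) (fromℤ (S₁ m k)) x (x ^ k))) ⟩
      0# + sumLe m (λ k → x * (lam ^ (m ∸ k) * fromℤ (S₁ m k) * x ^ k))
        ≈⟨ +-identityˡ _ ⟩
      sumLe m (λ k → x * (lam ^ (m ∸ k) * fromℤ (S₁ m k) * x ^ k))
        ≈⟨ sym (sumLe-*ˡ m x _) ⟩
      x * stirlingSum m ∎

    -- The second half of the recurrence: the terms -m·S₁(m,k) contribute
    -- -mλ·(x)_{m,λ}; the top term vanishes because S₁(m,m+1) = 0.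
    stirlingSum-scale : ∀ m →
      sumLe (suc m) (λ k → lam ^ (suc m ∸ k) * - (fromℕ m * fromℤ (S₁ m k)) * x ^ k)
        ≈ - (fromℕ m * lam) * stirlingSum m
    stirlingSum-scale m = begin
      sumLe m term + lam ^ (m ∸ m) * - (N * fromℤ (S₁ m (suc m))) * x ^ suc m
        ≈⟨ +-congˡ topVanishes ⟩
      sumLe m term + 0#
        ≈⟨ +-identityʳ _ ⟩
      sumLe m term
        ≈⟨ sumLe-cong≤ m rearrange ⟩
      sumLe m (λ k → - (N * lam) * (lam ^ (m ∸ k) * fromℤ (S₁ m k) * x ^ k))
        ≈⟨ sym (sumLe-*ˡ m _ _) ⟩
      - (N * lam) * stirlingSum m ∎
      where
      N = fromℕ m
      term : ℕ → Carrier
      term k = lam ^ (suc m ∸ k) * - (N * fromℤ (S₁ m k)) * x ^ k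
      topVanishes : lam ^ (m ∸ m) * - (N * fromℤ (S₁ m (suc m))) * x ^ suc m ≈ 0#
      topVanishes rewrite S₁-vanish {m} {suc m} ℕP.≤-refl =
        trans (*-congʳ (*-congˡ (trans (-‿cong (zeroʳ _)) -0#≈0#)))
              (trans (*-congʳ (zeroʳ _)) (zeroˡ _))
      rearrange : ∀ k → k ≤ m → term k ≈ - (N * lam) * (lam ^ (m ∸ k) * fromℤ (S₁ m k) * x ^ k)
      rearrange k k≤m rewrite ℕP.+-∸-assoc 1 k≤m = begin
        lam * a * - (N * s) * y      ≈⟨ *-congʳ (sym (-‿distribʳ-* _ _)) ⟩
        - (lam * a * (N * s)) * y    ≈⟨ sym (-‿distribˡ-* _ _) ⟩
        - (lam * a * (N * s) * y)    ≈⟨ -‿cong (*-solve 5 (λ l a n s y → (((l :* a) :* (n :* s)) :* y) ⊜* ((n :* l) :* ((a :* s) :* y))) refl lam a N s y) ⟩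
        - (N * lam * (a * s * y))    ≈⟨ -‿distribˡ-* _ _ ⟩
        - (N * lam) * (a * s * y)    ∎
        where
        a = lam ^ (m ∸ k)
        s = fromℤ (S₁ m k)
        y = x ^ k

    stirlingSum-suc : ∀ m → stirlingSum (suc m) ≈ (x - fromℕ m * lam) * stirlingSum m
    stirlingSum-suc m = begin
      stirlingSum (suc m)
        ≈⟨ sumLe-cong (suc m) (λ k → *-congʳ (*-congˡ (fromℤ-S₁-suc m k))) ⟩
      sumLe (suc m) (λ k → lam ^ (suc m ∸ k) * (A k - N * fromℤ (S₁ m k)) * x ^ k)
        ≈⟨ sumLe-cong (suc m) (λ k → trans (*-congʳ (distribˡ _ _ _)) (distribʳ _ _ _)) ⟩
      sumLe (suc m) (λ k → lam ^ (suc m ∸ k) * A k * x ^ k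
                         + lam ^ (suc m ∸ k) * - (N * fromℤ (S₁ m k)) * x ^ k)
        ≈⟨ sumLe-+ (suc m) _ _ ⟩
      _ + _
        ≈⟨ +-cong (stirlingSum-shift m) (stirlingSum-scale m) ⟩
      x * stirlingSum m + - (N * lam) * stirlingSum m
        ≈⟨ sym (distribʳ _ _ _) ⟩
      (x - N * lam) * stirlingSum m ∎
      where
      N = fromℕ m
      A : ℕ → Carrier
      A k = fromℤ (coeff (+ 0 ∷ fallingPoly m) k)

    -- The expansion with an extra factor on each side, in the shape of the theorem.
    stirlingSum-sandwich : ∀ a b m →
      a * stirlingSum m * b ≈ sumLe m (λ k → a * lam ^ (m ∸ k) * fromℤ (S₁ m k) * b * x ^ k)
    stirlingSum-sandwich a b m =
      trans (*-congʳ (sumLe-*ˡ m a _)) (trans (sumLe-*ʳ m b _) (sumLe-cong m (λ k →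
        *-solve 5 (λ a l s y b → ((a :* ((l :* s) :* y)) :* b) ⊜* ((((a :* l) :* s) :* b) :* y))
                  refl a (lam ^ (m ∸ k)) (fromℤ (S₁ m k)) (x ^ k) b)))

    degFalling-expansion : ∀ m → degFalling m ≈ stirlingSum m
    degFalling-expansion zero = sym (trans (*-identityʳ _) (trans (*-identityˡ _) (+-identityʳ _)))
    degFalling-expansion (suc m) =
      trans (*-congˡ (degFalling-expansion m)) (sym (stirlingSum-suc m))

module PowerSeries {c ℓ : Level} (R : CommutativeRing c ℓ) (F : IsCharZeroField R) where
  open CommutativeRing R hiding (zero)
  open RingHelpers R
  open IsCharZeroField F
  open DegenerateBell R F
  open RingFacts R
  open import Algebra.Properties.Ring ring using (-0#≈0#; -1*x≈-x; -‿distribˡ-*)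
  open import Algebra.Properties.CommutativeSemigroup *-commutativeSemigroup using (x∙yz≈y∙xz)

  infix 4 _≋_
  _≋_ : PS → PS → Set ℓ
  f ≋ g = ∀ n → f n ≈ g n

  ⋆-cong : ∀ {f f′ g g′} → f ≋ f′ → g ≋ g′ → (f ⋆ g) ≋ (f′ ⋆ g′)
  ⋆-cong f≋f′ g≋g′ n = sumLe-cong n (λ i → *-cong (f≋f′ i) (g≋g′ (n ∸ i)))

  ⋆-congˡ : ∀ {f f′} g → f ≋ f′ → (f ⋆ g) ≋ (f′ ⋆ g)
  ⋆-congˡ g f≋f′ = ⋆-cong {g = g} {g′ = g} f≋f′ (λ _ → refl)

  ⋆-congʳ : ∀ f {g g′} → g ≋ g′ → (f ⋆ g) ≋ (f ⋆ g′)
  ⋆-congʳ f g≋g′ = ⋆-cong {f = f} {f′ = f} (λ _ → refl) g≋g′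

  ⋆-comm : ∀ f g → (f ⋆ g) ≋ (g ⋆ f)
  ⋆-comm f g n = trans (sumLe-reverse n _) (sumLe-cong≤ n (λ i i≤n →
    trans (*-comm _ _) (*-congʳ (reflexive (P.cong g (ℕP.m∸[m∸n]≡n i≤n))))))

  ⋆-assoc : ∀ f g h → ((f ⋆ g) ⋆ h) ≋ (f ⋆ (g ⋆ h))
  ⋆-assoc f g h n = begin
    sumLe n (λ i → sumLe i (λ j → f j * g (i ∸ j)) * h (n ∸ i))
      ≈⟨ sumLe-cong n (λ i → sumLe-*ʳ i (h (n ∸ i)) _) ⟩
    sumLe n (λ i → sumLe i (λ j → f j * g (i ∸ j) * h (n ∸ i)))
      ≈⟨ sumLe-triangle n (λ j i → f j * g (i ∸ j) * h (n ∸ i)) ⟩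
    sumLe n (λ j → sumLe (n ∸ j) (λ k → f j * g (j ℕ.+ k ∸ j) * h (n ∸ (j ℕ.+ k))))
      ≈⟨ sumLe-cong n (λ j → sumLe-cong (n ∸ j) (λ k →
           trans (*-cong (*-congˡ (reflexive (P.cong g (ℕP.m+n∸m≡n j k))))
                         (reflexive (P.cong h (P.sym (ℕP.∸-+-assoc n j k)))))
                 (*-assoc _ _ _))) ⟩
    sumLe n (λ j → sumLe (n ∸ j) (λ k → f j * (g k * h (n ∸ j ∸ k))))
      ≈⟨ sumLe-cong n (λ j → sym (sumLe-*ˡ (n ∸ j) (f j) _)) ⟩
    sumLe n (λ j → f j * sumLe (n ∸ j) (λ k → g k * h (n ∸ j ∸ k))) ∎

  ⋆-leftComm : ∀ f g h → (f ⋆ (g ⋆ h)) ≋ (g ⋆ (f ⋆ h))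
  ⋆-leftComm f g h n = begin
    (f ⋆ (g ⋆ h)) n  ≈⟨ sym (⋆-assoc f g h n) ⟩
    ((f ⋆ g) ⋆ h) n  ≈⟨ ⋆-congˡ h (⋆-comm f g) n ⟩
    ((g ⋆ f) ⋆ h) n  ≈⟨ ⋆-assoc g f h n ⟩
    (g ⋆ (f ⋆ h)) n  ∎

  ⋆-distribʳ : ∀ f g h → ((f ⊞ g) ⋆ h) ≋ ((f ⋆ h) ⊞ (g ⋆ h))
  ⋆-distribʳ f g h n = trans (sumLe-cong n (λ i → distribʳ _ _ _)) (sumLe-+ n _ _)

  ⋆-scaleˡ : ∀ a f g → (scalePS a f ⋆ g) ≋ scalePS a (f ⋆ g)
  ⋆-scaleˡ a f g n = trans (sumLe-cong n (λ i → *-assoc _ _ _)) (sym (sumLe-*ˡ n a _))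

  ⋆-scaleʳ : ∀ a f g → (f ⋆ scalePS a g) ≋ scalePS a (f ⋆ g)
  ⋆-scaleʳ a f g n = trans (sumLe-cong n (λ i → x∙yz≈y∙xz _ _ _)) (sym (sumLe-*ˡ n a _))

  const⋆ : ∀ a f → (const a ⋆ f) ≋ scalePS a f
  const⋆ a f zero = refl
  const⋆ a f (suc n) = trans (sumLe-head n _)
    (trans (+-congˡ (sumLe-zero n _ (λ i _ → zeroˡ _))) (+-identityʳ _))

  D : PS → PS
  D f n = fromℕ (suc n) * f (suc n)

  D-const : ∀ a n → D (const a) n ≈ 0#
  D-const a n = zeroʳ _

  leibniz : ∀ f g → D (f ⋆ g) ≋ ((D f ⋆ g) ⊞ (f ⋆ D g))
  leibniz f g n = begin
    fromℕ (suc n) * sumLe (suc n) (λ i → f i * g (suc n ∸ i))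
      ≈⟨ sumLe-*ˡ (suc n) _ _ ⟩
    sumLe (suc n) (λ i → fromℕ (suc n) * (f i * g (suc n ∸ i)))
      ≈⟨ sumLe-cong≤ (suc n) split ⟩
    sumLe (suc n) (λ i → fromℕ i * (f i * g (suc n ∸ i)) + fromℕ (suc n ∸ i) * (f i * g (suc n ∸ i)))
      ≈⟨ sumLe-+ (suc n) _ _ ⟩
    sumLe (suc n) (λ i → fromℕ i * (f i * g (suc n ∸ i)))
      + sumLe (suc n) (λ i → fromℕ (suc n ∸ i) * (f i * g (suc n ∸ i)))
      ≈⟨ +-cong derivativeOfLeft derivativeOfRight ⟩
    (D f ⋆ g) n + (f ⋆ D g) n ∎
    where
    -- n+1 = i + (n+1-i) splits each term in two.
    split : ∀ i → i ≤ suc n → fromℕ (suc n) * (f i * g (suc n ∸ i))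
      ≈ fromℕ i * (f i * g (suc n ∸ i)) + fromℕ (suc n ∸ i) * (f i * g (suc n ∸ i))
    split i i≤ = trans (*-congʳ (trans (reflexive (P.cong fromℕ (P.sym (ℕP.m+[n∸m]≡n i≤))))
                                       (fromℕ-+ i (suc n ∸ i))))
                       (distribʳ _ _ _)
    -- the i = 0 term of the first sum is zero
    derivativeOfLeft : sumLe (suc n) (λ i → fromℕ i * (f i * g (suc n ∸ i))) ≈ (D f ⋆ g) n
    derivativeOfLeft = trans (sumLe-head n _) (trans (+-congʳ (zeroˡ _)) (trans (+-identityˡ _)
      (sumLe-cong n (λ i → sym (*-assoc _ _ _)))))
    -- the i = n+1 term of the second sum is zero
    derivativeOfRight : sumLe (suc n) (λ i → fromℕ (suc n ∸ i) * (f i * g (suc n ∸ i))) ≈ (f ⋆ D g) n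
    derivativeOfRight = trans (+-congˡ (trans (*-congʳ (reflexive (P.cong fromℕ (ℕP.n∸n≡0 n)))) (zeroˡ _)))
      (trans (+-identityʳ _) (sumLe-cong≤ n step))
      where
      step : ∀ i → i ≤ n → fromℕ (suc n ∸ i) * (f i * g (suc n ∸ i))
        ≈ f i * (fromℕ (suc (n ∸ i)) * g (suc (n ∸ i)))
      step i i≤n rewrite ℕP.+-∸-assoc 1 i≤n = x∙yz≈y∙xz _ _ _

  module Exp (v : PS) (v₀ : v 0 ≈ 0#) where
    pow-vanish : ∀ k n → n < k → powPS v k n ≈ 0#
    pow-vanish (suc k) n n<1+k = sumLe-zero n _ (term n n<1+k)
      where
      term : ∀ n → n < suc k → ∀ i → i ≤ n → v i * powPS v k (n ∸ i) ≈ 0#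
      term n _ zero _ = trans (*-congʳ v₀) (zeroˡ _)
      term (suc n) (s≤s n<k) (suc i) _ =
        trans (*-congˡ (pow-vanish k (n ∸ i) (ℕP.≤-<-trans (ℕP.m∸n≤m n i) n<k))) (zeroʳ _)

    D-pow : ∀ k → D (powPS v (suc k)) ≋ scalePS (fromℕ (suc k)) (D v ⋆ powPS v k)
    v⋆D-pow : ∀ k → (v ⋆ D (powPS v k)) ≋ scalePS (fromℕ k) (D v ⋆ powPS v k)

    D-pow k n = begin
      D (v ⋆ powPS v k) n                                      ≈⟨ leibniz v (powPS v k) n ⟩
      (D v ⋆ powPS v k) n + (v ⋆ D (powPS v k)) n              ≈⟨ +-cong (sym (*-identityˡ _)) (v⋆D-pow k n) ⟩
      1# * (D v ⋆ powPS v k) n + fromℕ k * (D v ⋆ powPS v k) n ≈⟨ sym (distribʳ _ _ _) ⟩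
      fromℕ (suc k) * (D v ⋆ powPS v k) n                      ∎

    v⋆D-pow zero n =
      trans (sumLe-zero n _ (λ i _ → trans (*-congˡ (D-const 1# (n ∸ i))) (zeroʳ _)))
            (sym (zeroˡ _))
    v⋆D-pow (suc k) n = begin
      (v ⋆ D (powPS v (suc k))) n          ≈⟨ ⋆-congʳ v (D-pow k) n ⟩
      (v ⋆ scalePS N (D v ⋆ powPS v k)) n  ≈⟨ ⋆-scaleʳ N v (D v ⋆ powPS v k) n ⟩
      N * (v ⋆ (D v ⋆ powPS v k)) n        ≈⟨ *-congˡ (⋆-leftComm v (D v) (powPS v k) n) ⟩
      N * (D v ⋆ powPS v (suc k)) n        ∎
      where N = fromℕ (suc k)

    expPS-truncate : ∀ N n → n ≤ N → sumLe N (λ k → invFact k * powPS v k n) ≈ expPS v n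
    expPS-truncate N n n≤N =
      sumLe-truncate N n _ n≤N (λ k n<k → trans (*-congˡ (pow-vanish k n n<k)) (zeroʳ _))

    -- (k+1)!⁻¹·(k+1) = k!⁻¹, so differentiating the series for exp shifts it.
    invFact-suc : ∀ k → invFact (suc k) * fromℕ (suc k) ≈ invFact k
    invFact-suc k = begin
      invFact k * recipSuc k * fromℕ (suc k)    ≈⟨ *-assoc _ _ _ ⟩
      invFact k * (recipSuc k * fromℕ (suc k))  ≈⟨ *-congˡ (trans (*-comm _ _) (inv-right _ _)) ⟩
      invFact k * 1#                            ≈⟨ *-identityʳ _ ⟩
      invFact k                                 ∎

    D-exp : D (expPS v) ≋ (D v ⋆ expPS v)
    D-exp n = begin
      fromℕ (suc n) * sumLe (suc n) (λ k → invFact k * powPS v k (suc n))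
        ≈⟨ trans (sumLe-*ˡ (suc n) _ _) (sumLe-cong (suc n) (λ k → x∙yz≈y∙xz _ _ _)) ⟩
      sumLe (suc n) (λ k → invFact k * D (powPS v k) n)
        ≈⟨ sumLe-head n _ ⟩
      invFact 0 * D (const 1#) n + sumLe n (λ k → invFact (suc k) * D (powPS v (suc k)) n)
        ≈⟨ +-cong (trans (*-congˡ (D-const 1# n)) (zeroʳ _)) (sumLe-cong n shiftTerm) ⟩
      0# + sumLe n (λ k → invFact k * sumLe n (λ i → D v i * powPS v k (n ∸ i)))
        ≈⟨ trans (+-identityˡ _) (sumLe-cong n (λ k → trans (sumLe-*ˡ n _ _)
                   (sumLe-cong n (λ i → x∙yz≈y∙xz _ _ _)))) ⟩
      sumLe n (λ k → sumLe n (λ i → D v i * (invFact k * powPS v k (n ∸ i))))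
        ≈⟨ sumLe-swap n n _ ⟩
      sumLe n (λ i → sumLe n (λ k → D v i * (invFact k * powPS v k (n ∸ i))))
        ≈⟨ sumLe-cong n (λ i → sym (sumLe-*ˡ n _ _)) ⟩
      sumLe n (λ i → D v i * sumLe n (λ k → invFact k * powPS v k (n ∸ i)))
        ≈⟨ sumLe-cong n (λ i → *-congˡ (expPS-truncate n (n ∸ i) (ℕP.m∸n≤m n i))) ⟩
      (D v ⋆ expPS v) n ∎
      where
      shiftTerm : ∀ k → invFact (suc k) * D (powPS v (suc k)) n ≈ invFact k * (D v ⋆ powPS v k) n
      shiftTerm k = begin
        invFact (suc k) * D (powPS v (suc k)) n                  ≈⟨ *-congˡ (D-pow k n) ⟩
        invFact (suc k) * (fromℕ (suc k) * (D v ⋆ powPS v k) n)  ≈⟨ sym (*-assoc _ _ _) ⟩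
        invFact (suc k) * fromℕ (suc k) * (D v ⋆ powPS v k) n    ≈⟨ *-congʳ (invFact-suc k) ⟩
        invFact k * (D v ⋆ powPS v k) n                          ∎

  exp-zero : ∀ v → (∀ n → v n ≈ 0#) → expPS v ≋ const 1#
  exp-zero v v≈0 zero = *-identityˡ _
  exp-zero v v≈0 (suc n) = trans (sumLe-head n _)
    (trans (+-cong (zeroʳ _) (sumLe-zero n _ (λ k _ → trans (*-congˡ (vanish k)) (zeroʳ _))))
           (+-identityʳ _))
    where
    vanish : ∀ k → powPS v (suc k) (suc n) ≈ 0#
    vanish k = sumLe-zero (suc n) _ (λ i _ → trans (*-congʳ (v≈0 i)) (zeroˡ _))

  ⋆-binomial : ∀ f g n → fromℕ (n !) * (f ⋆ g) n
    ≈ sumLe n (λ m → fromℕ (n C m) * (fromℕ (m !) * f m) * (fromℕ ((n ∸ m) !) * g (n ∸ m)))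
  ⋆-binomial f g n = trans (sumLe-*ˡ n _ _) (sumLe-cong≤ n term)
    where
    term : ∀ m → m ≤ n → fromℕ (n !) * (f m * g (n ∸ m))
      ≈ fromℕ (n C m) * (fromℕ (m !) * f m) * (fromℕ ((n ∸ m) !) * g (n ∸ m))
    term m m≤n = begin
      fromℕ (n !) * (f m * g (n ∸ m))
        ≈⟨ *-congʳ (reflexive (P.cong fromℕ (P.sym (binomial-factorials m≤n)))) ⟩
      fromℕ ((n C m) ℕ.* (m ! ℕ.* (n ∸ m) !)) * (f m * g (n ∸ m))
        ≈⟨ *-congʳ (trans (fromℕ-* (n C m) _) (*-congˡ (fromℕ-* (m !) ((n ∸ m) !)))) ⟩
      fromℕ (n C m) * (fromℕ (m !) * fromℕ ((n ∸ m) !)) * (f m * g (n ∸ m))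
        ≈⟨ *-solve 5 (λ c a b u w → ((c :* (a :* b)) :* (u :* w)) ⊜* ((c :* (a :* u)) :* (b :* w)))
                     refl (fromℕ (n C m)) (fromℕ (m !)) (fromℕ ((n ∸ m) !)) (f m) (g (n ∸ m)) ⟩
      fromℕ (n C m) * (fromℕ (m !) * f m) * (fromℕ ((n ∸ m) !) * g (n ∸ m)) ∎

  module Degenerate (lam : Carrier) (lam≢0 : ¬ (lam ≈ 0#)) where
    onePlusLamT : PS
    onePlusLamT = const 1# ⊞ lamT lam

    lamT⋆-zero : ∀ f → (lamT lam ⋆ f) 0 ≈ 0#
    lamT⋆-zero f = zeroˡ _

    lamT⋆-suc : ∀ f n → (lamT lam ⋆ f) (suc n) ≈ lam * f n
    lamT⋆-suc f n = begin
      (lamT lam ⋆ f) (suc n)                                ≈⟨ sumLe-head n _ ⟩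
      0# * f (suc n) + sumLe n (λ i → lamT lam (suc i) * f (n ∸ i)) ≈⟨ +-cong (zeroˡ _) (tail n) ⟩
      0# + lam * f n                                         ≈⟨ +-identityˡ _ ⟩
      lam * f n                                              ∎
      where
      tail : ∀ n → sumLe n (λ i → lamT lam (suc i) * f (n ∸ i)) ≈ lam * f n
      tail zero = refl
      tail (suc m) = trans (sumLe-head m _)
        (trans (+-congˡ (sumLe-zero m _ (λ _ _ → zeroˡ _))) (+-identityʳ _))

    onePlusLamT⋆ : ∀ f n → (onePlusLamT ⋆ f) n ≈ f n + (lamT lam ⋆ f) n
    onePlusLamT⋆ f n =
      trans (⋆-distribʳ (const 1#) (lamT lam) f n) (+-congʳ (trans (const⋆ 1# f n) (*-identityˡ _)))

    lamT-pow-diag : ∀ k → powPS (lamT lam) k k ≈ lam ^ k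
    lamT-pow-diag zero = refl
    lamT-pow-diag (suc k) = trans (lamT⋆-suc (powPS (lamT lam) k) k) (*-congˡ (lamT-pow-diag k))

    lamT-pow-off : ∀ k n → ¬ (n ≡ k) → powPS (lamT lam) k n ≈ 0#
    lamT-pow-off zero zero n≢k = ⊥-elim (n≢k P.refl)
    lamT-pow-off zero (suc n) n≢k = refl
    lamT-pow-off (suc k) zero n≢k = lamT⋆-zero (powPS (lamT lam) k)
    lamT-pow-off (suc k) (suc n) n≢k = trans (lamT⋆-suc (powPS (lamT lam) k) n)
      (trans (*-congˡ (lamT-pow-off k n (λ n≡k → n≢k (P.cong suc n≡k)))) (zeroʳ _))

    L : PS
    L = log1+ (lamT lam)

    -- log(1+λt) = Σ_{n≥0} (-1)ⁿ λ^{n+1} t^{n+1}/(n+1): only the term k = n of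
    -- the defining sum contributes to the coefficient of t^{n+1}.
    log-coeff : ∀ n → L (suc n) ≈ (- 1#) ^ n * recipSuc n * lam ^ suc n
    log-coeff n = trans
      (+-cong (sumLt-zero n _ (λ k k<n → trans (*-congˡ (lamT-pow-off (suc k) (suc n)
                 (λ n≡k → ℕP.<-irrefl (ℕP.suc-injective (P.sym n≡k)) k<n))) (zeroʳ _)))
              (*-congˡ (lamT-pow-diag (suc n))))
      (+-identityˡ _)

    D-log : ∀ n → D L n ≈ (- 1#) ^ n * lam ^ suc n
    D-log n = begin
      fromℕ (suc n) * L (suc n)                              ≈⟨ *-congˡ (log-coeff n) ⟩
      fromℕ (suc n) * ((- 1#) ^ n * recipSuc n * lam ^ suc n)
        ≈⟨ *-solve 4 (λ N s r l → (N :* ((s :* r) :* l)) ⊜* ((N :* r) :* (s :* l))) refl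
                     (fromℕ (suc n)) ((- 1#) ^ n) (recipSuc n) (lam ^ suc n) ⟩
      (fromℕ (suc n) * recipSuc n) * ((- 1#) ^ n * lam ^ suc n) ≈⟨ *-congʳ (inv-right _ _) ⟩
      1# * ((- 1#) ^ n * lam ^ suc n)                         ≈⟨ *-identityˡ _ ⟩
      (- 1#) ^ n * lam ^ suc n                                ∎

    log-ODE : (onePlusLamT ⋆ D L) ≋ const lam
    log-ODE n = trans (onePlusLamT⋆ (D L) n) (coefficient n)
      where
      coefficient : ∀ n → D L n + (lamT lam ⋆ D L) n ≈ const lam n
      coefficient zero = begin
        D L 0 + (lamT lam ⋆ D L) 0  ≈⟨ +-cong (D-log 0) (lamT⋆-zero (D L)) ⟩
        1# * (lam * 1#) + 0#         ≈⟨ trans (+-identityʳ _) (trans (*-identityˡ _) (*-identityʳ _)) ⟩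
        lam                          ∎
      coefficient (suc m) = begin
        D L (suc m) + (lamT lam ⋆ D L) (suc m)
          ≈⟨ +-cong (D-log (suc m)) (trans (lamT⋆-suc (D L) m) (*-congˡ (D-log m))) ⟩
        (- 1# * s) * (lam * p) + lam * (s * p)  ≈⟨ +-congʳ (*-congʳ (-1*x≈-x s)) ⟩
        (- s) * (lam * p) + lam * (s * p)       ≈⟨ +-congʳ (sym (-‿distribˡ-* _ _)) ⟩
        - (s * (lam * p)) + lam * (s * p)       ≈⟨ +-congʳ (-‿cong (x∙yz≈y∙xz _ _ _)) ⟩
        - (lam * (s * p)) + lam * (s * p)       ≈⟨ -‿inverseˡ _ ⟩
        0#                                      ∎
        where
        s = (- 1#) ^ m
        p = lam ^ suc m

    module Power (x : Carrier) where
      E : PS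
      E = degPow lam lam≢0 x

      x/λ : Carrier
      x/λ = x * inv lam lam≢0

      x/λ*λ : x/λ * lam ≈ x
      x/λ*λ = trans (*-assoc _ _ _)
        (trans (*-congˡ (trans (*-comm _ _) (inv-right _ _))) (*-identityʳ _))

      open Exp (scalePS x/λ L) (zeroʳ _) using (D-exp)

      E₀ : E 0 ≈ 1#
      E₀ = *-identityˡ _

      D-E : D E ≋ scalePS x/λ (D L ⋆ E)
      D-E n = begin
        D E n                              ≈⟨ D-exp n ⟩
        (D (scalePS x/λ L) ⋆ E) n          ≈⟨ ⋆-congˡ E (λ m → x∙yz≈y∙xz _ _ _) n ⟩
        (scalePS x/λ (D L) ⋆ E) n          ≈⟨ ⋆-scaleˡ x/λ (D L) E n ⟩
        x/λ * (D L ⋆ E) n                  ∎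

      degPow-ODE : (onePlusLamT ⋆ D E) ≋ scalePS x E
      degPow-ODE n = begin
        (onePlusLamT ⋆ D E) n                      ≈⟨ ⋆-congʳ onePlusLamT D-E n ⟩
        (onePlusLamT ⋆ scalePS x/λ (D L ⋆ E)) n    ≈⟨ ⋆-scaleʳ x/λ onePlusLamT (D L ⋆ E) n ⟩
        x/λ * (onePlusLamT ⋆ (D L ⋆ E)) n          ≈⟨ *-congˡ (sym (⋆-assoc onePlusLamT (D L) E n)) ⟩
        x/λ * ((onePlusLamT ⋆ D L) ⋆ E) n          ≈⟨ *-congˡ (⋆-congˡ E log-ODE n) ⟩
        x/λ * (const lam ⋆ E) n                    ≈⟨ *-congˡ (const⋆ lam E n) ⟩
        x/λ * (lam * E n)                          ≈⟨ sym (*-assoc _ _ _) ⟩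
        x/λ * lam * E n                            ≈⟨ *-congʳ x/λ*λ ⟩
        x * E n                                    ∎

      degPow-suc : ∀ m → fromℕ (suc m) * E (suc m) ≈ (x - fromℕ m * lam) * E m
      degPow-suc zero = begin
        D E 0                                   ≈⟨ sym (+-identityʳ _) ⟩
        D E 0 + 0#                              ≈⟨ +-congˡ (sym (lamT⋆-zero (D E))) ⟩
        D E 0 + (lamT lam ⋆ D E) 0              ≈⟨ sym (onePlusLamT⋆ (D E) 0) ⟩
        (onePlusLamT ⋆ D E) 0                   ≈⟨ degPow-ODE 0 ⟩
        x * E 0                                 ≈⟨ *-congʳ (sym x-0λ≈x) ⟩
        (x - 0# * lam) * E 0                    ∎
        where
        x-0λ≈x : x - 0# * lam ≈ x
        x-0λ≈x = trans (+-congˡ (trans (-‿cong (zeroˡ _)) -0#≈0#)) (+-identityʳ _)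
      degPow-suc (suc m) = begin
        D E (suc m)                             ≈⟨ subtract ode ⟩
        x * e - lam * (N * e)                   ≈⟨ +-congˡ (-‿cong (trans (sym (*-assoc _ _ _)) (*-congʳ (*-comm _ _)))) ⟩
        x * e - N * lam * e                     ≈⟨ +-congˡ (-‿distribˡ-* _ _) ⟩
        x * e + (- (N * lam)) * e               ≈⟨ sym (distribʳ _ _ _) ⟩
        (x - N * lam) * e                       ∎
        where
        N = fromℕ (suc m)
        e = E (suc m)
        ode : D E (suc m) + lam * (N * e) ≈ x * e
        ode = trans (+-congˡ (sym (lamT⋆-suc (D E) m)))
                    (trans (sym (onePlusLamT⋆ (D E) (suc m))) (degPow-ODE (suc m)))

      degPow-coeff : ∀ m → fromℕ (m !) * E m ≈ DegenerateFalling.degFalling lam x m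
      degPow-coeff zero = trans (*-congʳ (+-identityʳ _)) (trans (*-identityˡ _) E₀)
      degPow-coeff (suc m) = begin
        fromℕ (suc m ℕ.* m !) * E (suc m)            ≈⟨ *-congʳ (fromℕ-* (suc m) (m !)) ⟩
        fromℕ (suc m) * fromℕ (m !) * E (suc m)      ≈⟨ *-solve 3 (λ a b e → ((a :* b) :* e) ⊜* (b :* (a :* e))) refl _ _ _ ⟩
        fromℕ (m !) * (fromℕ (suc m) * E (suc m))    ≈⟨ *-congˡ (degPow-suc m) ⟩
        fromℕ (m !) * ((x - fromℕ m * lam) * E m)    ≈⟨ x∙yz≈y∙xz _ _ _ ⟩
        (x - fromℕ m * lam) * (fromℕ (m !) * E m)    ≈⟨ *-congˡ (degPow-coeff m) ⟩
        (x - fromℕ m * lam) * DegenerateFalling.degFalling lam x m ∎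

    G : PS
    G = invPS (const (1# + 1#) ⊟ degPow lam lam≢0 1#)

    -- b_{n,λ} = n!·Gₙ, because (1+λt)^{0/λ} = exp 0 = 1.
    bNum-coeff : ∀ n → bNum lam lam≢0 n ≈ fromℕ (n !) * G n
    bNum-coeff n = *-congˡ (begin
      (G ⋆ Power.E 0#) n   ≈⟨ ⋆-congʳ G (exp-zero _ (λ i → trans (*-congʳ (zeroˡ _)) (zeroˡ _))) n ⟩
      (G ⋆ const 1#) n     ≈⟨ ⋆-comm G (const 1#) n ⟩
      (const 1# ⋆ G) n     ≈⟨ const⋆ 1# G n ⟩
      1# * G n             ≈⟨ *-identityˡ _ ⟩
      G n                  ∎)

theorem4 : {c ℓ : Level} (R : CommutativeRing c ℓ) (F : IsCharZeroField R)
    → let open CommutativeRing R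
          open RingHelpers R
          open DegenerateBell R F
      in (lam : Carrier) (lam≢0 : ¬ (lam ≈ 0#)) (n : ℕ) (x : Carrier)
    → bPoly lam lam≢0 n x
      ≈ sumLe n (λ m → sumLe m (λ k →
          fromℕ (n C m) * lam ^ (m ∸ k) * fromℤ (S₁ m k)
            * bNum lam lam≢0 (n ∸ m) * x ^ k))
theorem4 R F lam lam≢0 n x = begin
  fromℕ (n !) * (G ⋆ E) n
    ≈⟨ *-congˡ (⋆-comm G E n) ⟩
  fromℕ (n !) * (E ⋆ G) n
    ≈⟨ ⋆-binomial E G n ⟩
  sumLe n (λ m → fromℕ (n C m) * (fromℕ (m !) * E m) * (fromℕ ((n ∸ m) !) * G (n ∸ m)))
    ≈⟨ sumLe-cong n (λ m → *-cong (*-congˡ (trans (degPow-coeff m) (degFalling-expansion m)))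
                                  (sym (bNum-coeff (n ∸ m)))) ⟩
  sumLe n (λ m → fromℕ (n C m) * stirlingSum m * bNum lam lam≢0 (n ∸ m))
    ≈⟨ sumLe-cong n (λ m → stirlingSum-sandwich (fromℕ (n C m)) (bNum lam lam≢0 (n ∸ m)) m) ⟩
  sumLe n (λ m → sumLe m (λ k →
    fromℕ (n C m) * lam ^ (m ∸ k) * fromℤ (S₁ m k) * bNum lam lam≢0 (n ∸ m) * x ^ k)) ∎
  where
  open CommutativeRing R hiding (zero)
  open RingHelpers R
  open DegenerateBell R F
  open RingFacts R
  open DegenerateFalling lam x
  open PowerSeries R F
  open Degenerate lam lam≢0
  open Power x
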